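{- If a graph $G$ satisfies the double-pairing property, then $G$ is a bipartite Helly graph.
   Context: Graphs are undirected, simple and connected; $d$ is the graph distance, $I(a,b)=\{w:d(a,w)+d(w,b)=d(a,b)\}$, $B_r(v)=\{x:d(v,x)\le r\}$. A profile is a finite sequence of vertices (repetitions allowed); $\pi^2$ is the concatenation of $\pi$ with itself; $F_\pi(v)=\sum_{x\in\pi}d(v,x)$ (with multiplicity). For a profile $\pi$ of even length $2n$, a pairing $P$ of $\pi$ is a partition of (the entries of) $\pi$ into $n$ pairs, and $D_\pi(P)=\sum_{\{a,b\}\in P}d(a,b)$. A pairing $P$ is perfect if $D_\pi(P)=F_\pi(v)$ for some vertex $v$. $G$ has the double-pairing property if for every profile $\pi$, the profile $\pi^2$ admits a perfect pairing. A bipartite graph with color classes $X,Y$ is a bipartite Helly graph if the family of half-balls $B_r(v)\cap X$, $B_r(v)\cap Y$ has the Helly property (every finite pairwise intersecting subfamily has nonempty intersection). -}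

module Defs where

open import Data.Nat using (ℕ; zero; suc; _≤_)
open import Data.Bool using (Bool)
open import Data.List using (List; []; _∷_; _++_; map; concatMap)
open import Data.Nat.ListAction using (sum)
open import Data.List.Membership.Propositional using (_∈_)
open import Data.List.Relation.Binary.Permutation.Propositional using (_↭_)
open import Data.Product using (Σ; ∃; _×_; _,_)
open import Data.Empty using (⊥)
open import Relation.Binary.PropositionalEquality using (_≡_)
open import Relation.Nullary using (¬_)

record Graph : Set₁ where
  field
    V       : Set
    _~_     : V → V → Set
    ~-sym   : ∀ {u v} → u ~ v → v ~ u
    ~-irrefl : ∀ {u} → ¬ (u ~ u)

module _ (G : Graph) where
  open Graph G

  data Walk : V → V → ℕ → Set where
    []  : ∀ {u} → Walk u u zero
    _∷_ : ∀ {u w v n} → u ~ w → Walk w v n → Walk u v (suc n)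

  -- d is the graph (shortest-path) distance of G.  This also forces G to be
  -- connected (every pair of vertices is joined by a walk).
  IsDistance : (V → V → ℕ) → Set
  IsDistance d =
    (∀ u v → Walk u v (d u v)) ×
    (∀ u v n → Walk u v n → d u v ≤ n)

  module _ (d : V → V → ℕ) where

    Profile : Set
    Profile = List V

    square : Profile → Profile
    square π = π ++ π

    F : Profile → V → ℕ
    F π v = sum (map (d v) π)

    flatten : List (V × V) → List V
    flatten = concatMap (λ { (a , b) → a ∷ b ∷ [] })

    IsPairing : Profile → List (V × V) → Set
    IsPairing π P = flatten P ↭ π

    D : List (V × V) → ℕ
    D P = sum (map (λ { (a , b) → d a b }) P)

    IsPerfectPairing : Profile → List (V × V) → Set
    IsPerfectPairing π P = IsPairing π P × ∃ λ v → D P ≡ F π v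

    DoublePairingProperty : Set
    DoublePairingProperty =
      ∀ (π : Profile) → ∃ λ P → IsPerfectPairing (square π) P

    ProperColouring : (V → Bool) → Set
    ProperColouring c = ∀ {u v} → u ~ v → ¬ (c u ≡ c v)

    -- half-ball B_r(v) ∩ (colour class b), described by (v , r , b)
    HalfBall : Set
    HalfBall = V × ℕ × Bool

    _∈HB_ : (c : V → Bool) → V → HalfBall → Set
    _∈HB_ c x (v , r , b) = (d v x ≤ r) × (c x ≡ b)

    HalfBallHelly : (V → Bool) → Set
    HalfBallHelly c =
      ∀ (ℱ : List HalfBall) →
        (∀ {A B} → A ∈ ℱ → B ∈ ℱ → ∃ λ x → _∈HB_ c x A × _∈HB_ c x B) →
        ∃ λ x → ∀ {A} → A ∈ ℱ → _∈HB_ c x A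

    BipartiteHelly : Set
    BipartiteHelly = Σ (V → Bool) λ c → ProperColouring c × HalfBallHelly c

-- Fix u and a list A whose points are spread as seen from u: d x y + 2 ≤ d u x + d u y.
-- A perfect pairing of the doubled profile that repeats u and the points of A with suitable
-- multiplicities is so cheap that its median w ≠ u lies on a geodesic from u to every point of A,
-- so the first step from u towards w brings u closer to all of A at once.
-- Applied to the two ends of an edge at equal distance n ≥ 2 from u this descends to n = 1,
-- where the profile of a triangle gives a contradiction; hence distances from a fixed root
-- properly 2-colour G. For pairwise intersecting half-balls of colour β, first lower each radius
-- to the parity that distances to colour β have from its centre; then the centres whose ball does
-- not contain u are spread as seen from u, and stepping closer to them repeatedly ends in a
-- vertex of colour β in every ball.

module Submission where

open import Defs
open import Data.Bool using (Bool; true; false; not; _xor_)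
open import Data.Bool.Properties using (not-involutive; not-injective; not-¬; ¬-not; xor-same; not-distribˡ-xor)
  renaming (_≟_ to _≟ᴮ_)
open import Data.Empty using (⊥-elim)
open import Function using (_∘_; id)
open import Data.List using (List; []; _∷_; [_]; _++_; map; length; filter)
open import Data.List.Membership.Propositional using (_∈_; find; lose)
open import Data.List.Membership.Propositional.Properties using (∈-++⁻; ∈-map⁺; ∈-map⁻; ∈-filter⁺; ∈-filter⁻)
open import Data.List.Relation.Unary.All as All using (All; []; _∷_)
open import Data.List.Relation.Unary.Any using (here; there; any?)
open import Data.List.Relation.Binary.Permutation.Propositional.Properties using (∈-resp-↭; map⁺)
open import Data.List.Properties using (map-++)
open import Data.Nat using (ℕ; zero; suc; pred; _+_; _*_; _≤_; _<_; _≤?_; _<?_; z≤n; s≤s)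
open import Data.Nat.ListAction using (sum)
open import Data.Nat.ListAction.Properties using (sum-++; sum-↭)
open import Data.Nat.Properties
open import Data.Nat.Tactic.RingSolver using (solve-∀)
open import Data.Product using (∃; _×_; _,_; proj₁; proj₂)
open import Data.Sum using (_⊎_; inj₁; inj₂)
open import Relation.Binary using (tri<; tri≈; tri>)
open import Relation.Binary.PropositionalEquality using (_≡_; _≢_; refl; sym; trans; cong; cong₂; subst; subst₂; module ≡-Reasoning)
open import Relation.Nullary using (¬_; yes; no)
open import Relation.Unary using (Decidable)

odd : ℕ → Bool
odd zero = false
odd (suc n) = not (odd n)

<∧odd≡⇒2+≤ : ∀ {m n} → m < n → odd m ≡ odd n → 2 + m ≤ n
<∧odd≡⇒2+≤ {m} m<n odd≡ = ≤∧≢⇒< m<n λ 1+m≡n → not-¬ refl (trans odd≡ (cong odd (sym 1+m≡n)))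

≤∧odd≢⇒< : ∀ {m n} → m ≤ n → odd m ≢ odd n → m < n
≤∧odd≢⇒< m≤n odd≢ = ≤∧≢⇒< m≤n (odd≢ ∘ cong odd)

-- the largest number ≤ r of parity b (r itself when there is none)
align : Bool → ℕ → ℕ
align b r with odd r ≟ᴮ b
... | yes _ = r
... | no  _ = pred r

align-≤ : ∀ b r → align b r ≤ r
align-≤ b r with odd r ≟ᴮ b
... | yes _ = ≤-refl
... | no  _ = pred[n]≤n

align-maximal : ∀ {b m r} → odd m ≡ b → m ≤ r → m ≤ align b r × odd (align b r) ≡ b
align-maximal {b} {m} {r} odd-m m≤r with odd r ≟ᴮ b
... | yes odd-r = m≤r , odd-r
... | no ¬odd-r with r
...   | zero = ⊥-elim (¬odd-r (subst (λ k → odd k ≡ b) (n≤0⇒n≡0 m≤r) odd-m))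
...   | suc r = ≤-pred (≤∧odd≢⇒< m≤r λ e → ¬odd-r (trans (sym e) odd-m)) , not-injective (¬-not ¬odd-r)

xor-injectiveʳ : ∀ a {b c} → a xor b ≡ a xor c → b ≡ c
xor-injectiveʳ true  = not-injective
xor-injectiveʳ false = id

∣2n-1∣ : ℕ → ℕ
∣2n-1∣ zero = 1
∣2n-1∣ (suc n) = suc (n + n)

2n≤1+∣2n-1∣ : ∀ n → 2 * n ≤ 1 + ∣2n-1∣ n
2n≤1+∣2n-1∣ zero = z≤n
2n≤1+∣2n-1∣ (suc n) = ≤-reflexive (identity n)
  where
  identity : ∀ n → 2 * suc n ≡ 2 + (n + n)
  identity = solve-∀

2c≤∣2a-1∣+∣2b-1∣ : ∀ {a b c} → 0 < a → 0 < b → c + 2 ≤ a + b → 2 * c ≤ ∣2n-1∣ a + ∣2n-1∣ b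
2c≤∣2a-1∣+∣2b-1∣ {suc a} {suc b} {c} _ _ c+2≤ = begin
  2 * c                   ≤⟨ *-monoʳ-≤ 2 c≤a+b ⟩
  2 * (a + b)             ≤⟨ m≤m+n _ 2 ⟩
  2 * (a + b) + 2         ≡⟨ identity a b ⟩
  suc (a + a) + suc (b + b) ∎
  where
  open ≤-Reasoning
  suc+suc : ∀ a b → suc a + suc b ≡ a + b + 2
  suc+suc = solve-∀
  identity : ∀ a b → 2 * (a + b) + 2 ≡ suc (a + a) + suc (b + b)
  identity = solve-∀
  c≤a+b : c ≤ a + b
  c≤a+b = +-cancelʳ-≤ 2 c (a + b) (subst (c + 2 ≤_) (suc+suc a b) c+2≤)

n+n≡2*n : ∀ n → n + n ≡ 2 * n
n+n≡2*n = solve-∀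

-- In the notation of median-on-geodesics, with τ = d u w and W = Σ d w x for the median w.
descent-arithmetic : ∀ {k p T τ W} → suc p ≡ k * suc T → p * τ + suc T * W < suc T * T →
                     T ≤ k * τ + W → 0 < τ × k * τ + W ≤ T
descent-arithmetic {k} {p} {T} {τ} {W} 1+p≡kq F<qT T≤ = 0<τ , ≤-pred kτ+W<1+T
  where
  q = suc T

  0<τ : 0 < τ
  0<τ = n≢0⇒n>0 λ { refl → <⇒≱ (*-cancelˡ-< q W T (subst (_< q * T) (cong (_+ q * W) (*-zeroʳ p)) F<qT))
                                 (subst (λ n → T ≤ n + W) (*-zeroʳ k) T≤) }

  T≤p : T ≤ p
  T≤p = at-least-one-copy {k} 1+p≡kq
    where
    at-least-one-copy : ∀ {k p} → suc p ≡ k * q → T ≤ p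
    at-least-one-copy {suc k} eq = subst (T ≤_) (suc-injective (sym eq)) (m≤m+n T (k * q))

  τ<q : τ < q
  τ<q = *-cancelˡ-< T τ q (begin-strict
    T * τ          ≤⟨ *-monoˡ-≤ τ T≤p ⟩
    p * τ          ≤⟨ m≤m+n (p * τ) (q * W) ⟩
    p * τ + q * W  <⟨ F<qT ⟩
    q * T          ≡⟨ *-comm q T ⟩
    T * q          ∎)
    where open ≤-Reasoning

  kτ+W<1+T : k * τ + W < suc T
  kτ+W<1+T = *-cancelˡ-< q (k * τ + W) (suc T) (begin-strict
    q * (k * τ + W)      ≡⟨ expand k q τ W ⟩
    k * q * τ + q * W    ≡⟨ cong (λ n → n * τ + q * W) 1+p≡kq ⟨
    suc p * τ + q * W    ≡⟨ +-assoc τ (p * τ) (q * W) ⟩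
    τ + (p * τ + q * W)  <⟨ +-mono-<-≤ τ<q (<⇒≤ F<qT) ⟩
    q + q * T            ≡⟨ *-suc q T ⟨
    q * suc T            ∎)
    where
    open ≤-Reasoning
    expand : ∀ k q τ W → q * (k * τ + W) ≡ k * q * τ + q * W
    expand = solve-∀

module _ {A : Set} where

  copies : ℕ → List A → List A
  copies zero xs = []
  copies (suc n) xs = xs ++ copies n xs

  ∈-copies⁻ : ∀ n {xs} {x : A} → x ∈ copies n xs → x ∈ xs
  ∈-copies⁻ (suc n) {xs} x∈ with ∈-++⁻ xs x∈
  ... | inj₁ x∈xs = x∈xs
  ... | inj₂ x∈copies = ∈-copies⁻ n x∈copies

  sum-map-++ : ∀ (f : A → ℕ) xs ys → sum (map f (xs ++ ys)) ≡ sum (map f xs) + sum (map f ys)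
  sum-map-++ f xs ys = trans (cong sum (map-++ f xs ys)) (sum-++ (map f xs) (map f ys))

  sum-map-copies : ∀ (f : A → ℕ) n xs → sum (map f (copies n xs)) ≡ n * sum (map f xs)
  sum-map-copies f zero xs = refl
  sum-map-copies f (suc n) xs =
    trans (sum-map-++ f xs (copies n xs)) (cong (sum (map f xs) +_) (sum-map-copies f n xs))

  sum-map-+ : ∀ t (f : A → ℕ) xs → sum (map (λ x → t + f x) xs) ≡ length xs * t + sum (map f xs)
  sum-map-+ t f [] = refl
  sum-map-+ t f (x ∷ xs) =
    trans (cong (t + f x +_) (sum-map-+ t f xs)) (+-+-comm t (f x) (length xs * t) (sum (map f xs)))
    where
    +-+-comm : ∀ a b c e → a + b + (c + e) ≡ a + c + (b + e)
    +-+-comm = solve-∀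

  sum-map-mono-≤ : ∀ {f g : A → ℕ} xs → (∀ {x} → x ∈ xs → f x ≤ g x) → sum (map f xs) ≤ sum (map g xs)
  sum-map-mono-≤ [] f≤g = z≤n
  sum-map-mono-≤ (x ∷ xs) f≤g = +-mono-≤ (f≤g (here refl)) (sum-map-mono-≤ xs (f≤g ∘ there))

  sum-map-∣2n-1∣ : ∀ (f : A → ℕ) xs → (∀ {x} → x ∈ xs → 0 < f x) →
                   sum (map (∣2n-1∣ ∘ f) xs) + length xs ≡ 2 * sum (map f xs)
  sum-map-∣2n-1∣ f [] _ = refl
  sum-map-∣2n-1∣ f (x ∷ xs) 0<f with f x | 0<f (here refl)
  ... | suc n | _ = begin
    suc (n + n) + S + suc (length xs)  ≡⟨ identity n S (length xs) ⟩
    2 * suc n + (S + length xs)        ≡⟨ cong (2 * suc n +_) (sum-map-∣2n-1∣ f xs (0<f ∘ there)) ⟩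
    2 * suc n + 2 * sum (map f xs)     ≡⟨ *-distribˡ-+ 2 (suc n) (sum (map f xs)) ⟨
    2 * (suc n + sum (map f xs))       ∎
    where
    open ≡-Reasoning
    S = sum (map (∣2n-1∣ ∘ f) xs)
    identity : ∀ n S L → suc (n + n) + S + suc L ≡ 2 * suc n + (S + L)
    identity = solve-∀

  pointwise-≤∧sum-≥⇒pointwise-≥ : ∀ {f g : A → ℕ} xs → (∀ {x} → x ∈ xs → f x ≤ g x) →
                                  sum (map g xs) ≤ sum (map f xs) → ∀ {x} → x ∈ xs → g x ≤ f x
  pointwise-≤∧sum-≥⇒pointwise-≥ {f} {g} (y ∷ xs) f≤g Σg≤Σf (here refl) with g y ≤? f y
  ... | yes gy≤fy = gy≤fy
  ... | no gy≰fy = ⊥-elim (<⇒≱ (+-mono-<-≤ (≰⇒> gy≰fy) (sum-map-mono-≤ xs (f≤g ∘ there))) Σg≤Σf)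
  pointwise-≤∧sum-≥⇒pointwise-≥ {f} {g} (y ∷ xs) f≤g Σg≤Σf (there x∈) =
    pointwise-≤∧sum-≥⇒pointwise-≥ xs (f≤g ∘ there)
      (+-cancelˡ-≤ (g y) _ _ (≤-trans Σg≤Σf (+-monoˡ-≤ _ (f≤g (here refl))))) x∈

module _ (G : Graph) (c : Graph.V G → Bool) (flips : ∀ {u v} → Graph._~_ G u v → c v ≡ not (c u)) where

  walk-parity : ∀ {a b n} → Walk G a b n → odd n ≡ c a xor c b
  walk-parity {a} [] = sym (xor-same (c a))
  walk-parity {a} {b} {suc n} (_∷_ {w = w} e p) = begin
    not (odd n)             ≡⟨ cong not (walk-parity p) ⟩
    not (c w xor c b)       ≡⟨ cong (λ x → not (x xor c b)) (flips e) ⟩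
    not (not (c a) xor c b) ≡⟨ not-distribˡ-xor (not (c a)) (c b) ⟩
    not (not (c a)) xor c b ≡⟨ cong (_xor c b) (not-involutive (c a)) ⟩
    c a xor c b             ∎
    where open ≡-Reasoning

module Metric (G : Graph) (d : Graph.V G → Graph.V G → ℕ) (isD : IsDistance G d) where
  open Graph G

  geodesic : ∀ u v → Walk G u v (d u v)
  geodesic = proj₁ isD

  d-minimal : ∀ {u v n} → Walk G u v n → d u v ≤ n
  d-minimal {u} {v} {n} = proj₂ isD u v n

  _++ʷ_ : ∀ {u w v m n} → Walk G u w m → Walk G w v n → Walk G u v (m + n)
  [] ++ʷ q = q
  (e ∷ p) ++ʷ q = e ∷ (p ++ʷ q)

  reverseʷ : ∀ {u v n} → Walk G u v n → Walk G v u n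
  reverseʷ [] = []
  reverseʷ {n = suc n} (e ∷ p) = subst (Walk G _ _) (+-comm n 1) (reverseʷ p ++ʷ (~-sym e ∷ []))

  d-sym : ∀ u v → d u v ≡ d v u
  d-sym u v = ≤-antisym (d-minimal (reverseʷ (geodesic v u))) (d-minimal (reverseʷ (geodesic u v)))

  d-triangle : ∀ u w v → d u v ≤ d u w + d w v
  d-triangle u w v = d-minimal (geodesic u w ++ʷ geodesic w v)

  d-refl : ∀ u → d u u ≡ 0
  d-refl u = n≤0⇒n≡0 (d-minimal {u} [])

  d≡0⇒≡ : ∀ {u v} → d u v ≡ 0 → u ≡ v
  d≡0⇒≡ {u} {v} eq with d u v | geodesic u v
  d≡0⇒≡ refl | zero | [] = refl

  d≡1⇒~ : ∀ {u v} → d u v ≡ 1 → u ~ v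
  d≡1⇒~ {u} {v} eq with d u v | geodesic u v
  d≡1⇒~ refl | suc zero | e ∷ [] = e

  ~⇒d≡1 : ∀ {u v} → u ~ v → d u v ≡ 1
  ~⇒d≡1 {u} {v} e = ≤-antisym (d-minimal (e ∷ [])) (n≢0⇒n>0 λ d≡0 → ~-irrefl (subst (u ~_) (sym (d≡0⇒≡ d≡0)) e))

  ~⇒d-≤-sucˡ : ∀ {u u'} → u ~ u' → ∀ x → d u x ≤ suc (d u' x)
  ~⇒d-≤-sucˡ {u} {u'} e x = subst (λ n → d u x ≤ n + d u' x) (~⇒d≡1 e) (d-triangle u u' x)

  ~⇒d-≤-sucʳ : ∀ {u u'} → u ~ u' → ∀ x → d x u' ≤ suc (d x u)
  ~⇒d-≤-sucʳ {u} {u'} e x = subst (λ n → d x u' ≤ n) (trans (cong (d x u +_) (~⇒d≡1 e)) (+-comm (d x u) 1)) (d-triangle x u u')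

  ~∧d<⇒suc-d≡d : ∀ {u u' x} → u ~ u' → d u' x < d u x → suc (d u' x) ≡ d u x
  ~∧d<⇒suc-d≡d {u} {u'} {x} e d< = ≤-antisym d< (~⇒d-≤-sucˡ e x)

  step-towards : ∀ u w → 0 < d u w → ∃ λ u' → u ~ u' × d u' w < d u w
  step-towards u w = first-step (geodesic u w)
    where
    first-step : ∀ {n} → Walk G u w n → 0 < n → ∃ λ u' → u ~ u' × d u' w < n
    first-step (e ∷ p) _ = _ , e , s≤s (d-minimal p)

  pairing-cost-bound : (g : V → ℕ) {σ : List V} {P : List (V × V)} → IsPairing G d σ P →
                       (∀ {a b} → a ∈ σ → b ∈ σ → 2 * d a b ≤ g a + g b) → 2 * D G d P ≤ sum (map g σ)
  pairing-cost-bound g {σ} {P} P-pairs σ-bound =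
    subst (2 * D G d P ≤_) (sum-↭ (map⁺ g P-pairs)) (bound P (λ a∈ b∈ → σ-bound (∈-resp-↭ P-pairs a∈) (∈-resp-↭ P-pairs b∈)))
    where
    bound : ∀ P → (∀ {a b} → a ∈ flatten G d P → b ∈ flatten G d P → 2 * d a b ≤ g a + g b) →
            2 * D G d P ≤ sum (map g (flatten G d P))
    bound [] _ = z≤n
    bound ((a , b) ∷ P) P-bound = begin
      2 * (d a b + D G d P)             ≡⟨ *-distribˡ-+ 2 (d a b) (D G d P) ⟩
      2 * d a b + 2 * D G d P           ≤⟨ +-mono-≤ (P-bound (here refl) (there (here refl)))
                                                     (bound P λ x∈ y∈ → P-bound (there (there x∈)) (there (there y∈))) ⟩
      g a + g b + sum (map g (flatten G d P)) ≡⟨ +-assoc (g a) (g b) _ ⟩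
      g a + (g b + sum (map g (flatten G d P))) ∎
      where open ≤-Reasoning

  Clique : List V → Set
  Clique σ = ∀ {a b} → a ∈ σ → b ∈ σ → a ≡ b ⊎ a ~ b

  clique-∷ : ∀ {x σ} → All (x ~_) σ → Clique σ → Clique (x ∷ σ)
  clique-∷ x~σ σ-clique (here refl) (here refl) = inj₁ refl
  clique-∷ x~σ σ-clique (here refl) (there b∈) = inj₂ (All.lookup x~σ b∈)
  clique-∷ x~σ σ-clique (there a∈) (here refl) = inj₂ (~-sym (All.lookup x~σ a∈))
  clique-∷ x~σ σ-clique (there a∈) (there b∈) = σ-clique a∈ b∈

  clique⇒d≤1 : ∀ {σ} → Clique σ → ∀ {a b} → a ∈ σ → b ∈ σ → d a b ≤ 1
  clique⇒d≤1 σ-clique a∈ b∈ with σ-clique a∈ b∈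
  ... | inj₁ refl = ≤-trans (≤-reflexive (d-refl _)) z≤n
  ... | inj₂ a~b = ≤-reflexive (~⇒d≡1 a~b)

  d-triangle-from : ∀ w a b → d a b ≤ d w a + d w b
  d-triangle-from w a b = subst (λ n → d a b ≤ n + d w b) (d-sym a w) (d-triangle a w b)

  perimeter-bound : ∀ w y u v → d y u + d y v + d u v ≤ 2 * F G d (y ∷ u ∷ v ∷ []) w
  perimeter-bound w y u v = begin
    d y u + d y v + d u v
      ≤⟨ +-mono-≤ (+-mono-≤ (d-triangle-from w y u) (d-triangle-from w y v)) (d-triangle-from w u v) ⟩
    d w y + d w u + (d w y + d w v) + (d w u + d w v)
      ≡⟨ identity (d w y) (d w u) (d w v) ⟩
    2 * (d w y + (d w u + (d w v + 0))) ∎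
    where
    open ≤-Reasoning
    identity : ∀ a b c → a + b + (a + c) + (b + c) ≡ 2 * (a + (b + (c + 0)))
    identity = solve-∀

module DoublePairing (G : Graph) (d : Graph.V G → Graph.V G → ℕ) (isD : IsDistance G d)
                     (dpp : DoublePairingProperty G d) where
  open Graph G
  open Metric G d isD

  median-bound : (σ : List V) (g : V → ℕ) → (∀ {a b} → a ∈ σ → b ∈ σ → 2 * d a b ≤ g a + g b) →
                 ∃ λ w → 2 * F G d σ w ≤ sum (map g σ)
  median-bound σ g σ-bound with dpp σ
  ... | P , P-pairs , w , D≡F = w , *-cancelˡ-≤ 2 (begin
    2 * (2 * F G d σ w)                        ≡⟨ cong (2 *_) (n+n≡2*n (F G d σ w)) ⟨
    2 * (F G d σ w + F G d σ w)                ≡⟨ cong (2 *_) (trans D≡F (sum-map-++ (d w) σ σ)) ⟨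
    2 * D G d P                                ≤⟨ pairing-cost-bound g {P = P} P-pairs (λ a∈ b∈ → σ-bound (undouble a∈) (undouble b∈)) ⟩
    sum (map g (σ ++ σ))                       ≡⟨ sum-map-++ g σ σ ⟩
    sum (map g σ) + sum (map g σ)              ≡⟨ n+n≡2*n (sum (map g σ)) ⟩
    2 * sum (map g σ)                          ∎)
    where
    open ≤-Reasoning
    undouble : ∀ {x} → x ∈ σ ++ σ → x ∈ σ
    undouble x∈ with ∈-++⁻ σ x∈
    ... | inj₁ x∈σ = x∈σ
    ... | inj₂ x∈σ = x∈σ

  triangle-free : ∀ {y u v} → y ~ u → y ~ v → ¬ (u ~ v)
  triangle-free {y} {u} {v} y~u y~v u~v =
    let w , 2F≤3 = median-bound σ (λ _ → 1) within-1
    in <⇒≱ (*-cancelˡ-< 2 (F G d σ w) 2 (s≤s 2F≤3)) (*-cancelˡ-< 2 1 (F G d σ w) (3≤2F w))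
    where
    σ = y ∷ u ∷ v ∷ []

    within-1 : ∀ {a b} → a ∈ σ → b ∈ σ → 2 * d a b ≤ 2
    within-1 a∈ b∈ = *-monoʳ-≤ 2 (clique⇒d≤1 (clique-∷ (y~u ∷ y~v ∷ []) (clique-∷ (u~v ∷ []) (clique-∷ [] λ ()))) a∈ b∈)

    3≤2F : ∀ w → 3 ≤ 2 * F G d σ w
    3≤2F w = subst₂ (λ a b → a + b + 1 ≤ 2 * F G d σ w) (~⇒d≡1 y~u) (~⇒d≡1 y~v)
               (subst (λ c → d y u + d y v + c ≤ 2 * F G d σ w) (~⇒d≡1 u~v) (perimeter-bound w y u v))

  -- Pairing u with u costs 0, u with x at most d u x, and x with y at most
  -- d u x + d u y − 2; this beats F(u) by just enough that the median must lie strictly away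
  -- from u and on a geodesic from u to every point of A.
  module _ (u a : V) (as : List V) (spread : ∀ {x y} → x ∈ a ∷ as → y ∈ a ∷ as → d x y + 2 ≤ d u x + d u y) where
    private
      A = a ∷ as
      T = sum (map (d u) A)
      q = suc T
      p = length as * q + T
      σ = copies p [ u ] ++ copies q A
      g : V → ℕ
      g = ∣2n-1∣ ∘ d u

      0<d : ∀ {x} → x ∈ A → 0 < d u x
      0<d {x} x∈ = n≢0⇒n>0 λ d≡0 → 2≰0 (subst (λ n → 2 ≤ n + n) d≡0 (≤-trans (m≤n+m 2 (d x x)) (spread x∈ x∈)))
        where
        2≰0 : ¬ (2 ≤ 0 + 0)
        2≰0 ()

      pair-bound : ∀ {x y} → x ≡ u ⊎ x ∈ A → y ≡ u ⊎ y ∈ A → 2 * d x y ≤ g x + g y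
      pair-bound (inj₁ refl) (inj₁ refl) = subst (λ n → 2 * n ≤ g u + g u) (sym (d-refl u)) z≤n
      pair-bound {y = y} (inj₁ refl) (inj₂ y∈) =
        subst (λ n → 2 * d u y ≤ ∣2n-1∣ n + g y) (sym (d-refl u)) (2n≤1+∣2n-1∣ (d u y))
      pair-bound {x} (inj₂ x∈) (inj₁ refl) =
        subst₂ (λ m n → 2 * m ≤ n) (d-sym u x) (+-comm (g u) (g x)) (pair-bound (inj₁ refl) (inj₂ x∈))
      pair-bound (inj₂ x∈) (inj₂ y∈) = 2c≤∣2a-1∣+∣2b-1∣ (0<d x∈) (0<d y∈) (spread x∈ y∈)

      σ-entry : ∀ {x} → x ∈ σ → x ≡ u ⊎ x ∈ A
      σ-entry x∈ with ∈-++⁻ (copies p [ u ]) x∈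
      ... | inj₁ x∈us = inj₁ (unique (∈-copies⁻ p x∈us))
        where
        unique : ∀ {x} → x ∈ [ u ] → x ≡ u
        unique (here x≡u) = x≡u
      ... | inj₂ x∈As = inj₂ (∈-copies⁻ q x∈As)

      total-weight : suc (sum (map g σ)) ≡ 2 * (q * T)
      total-weight = begin
        suc (sum (map g σ))                      ≡⟨ cong suc (sum-map-++ g (copies p [ u ]) (copies q A)) ⟩
        suc (sum (map g (copies p [ u ])) + GA′)  ≡⟨ cong (λ n → suc (n + GA′)) (sum-map-copies g p [ u ]) ⟩
        suc (p * (g u + 0) + GA′)                ≡⟨ cong (λ n → suc (p * (∣2n-1∣ n + 0) + GA′)) (d-refl u) ⟩
        suc (p * 1 + GA′)                        ≡⟨ cong (λ n → suc (p * 1 + n)) (sum-map-copies g q A) ⟩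
        suc (p * 1 + q * GA)                     ≡⟨ regroup (length as) T GA ⟩
        q * (GA + length A)                      ≡⟨ cong (q *_) (sum-map-∣2n-1∣ (d u) A 0<d) ⟩
        q * (2 * T)                              ≡⟨ *-comm q (2 * T) ⟩
        2 * T * q                                ≡⟨ *-assoc 2 T q ⟩
        2 * (T * q)                              ≡⟨ cong (2 *_) (*-comm T q) ⟩
        2 * (q * T)                              ∎
        where
        open ≡-Reasoning
        GA = sum (map g A)
        GA′ = sum (map g (copies q A))
        regroup : ∀ l T G → suc ((l * suc T + T) * 1 + suc T * G) ≡ suc T * (G + suc l)
        regroup = solve-∀

    median-on-geodesics : ∃ λ w → 0 < d u w × (∀ {x} → x ∈ A → d u w + d w x ≤ d u x)
    median-on-geodesics with median-bound σ g (λ x∈ y∈ → pair-bound (σ-entry x∈) (σ-entry y∈))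
    ... | w , 2F≤Σg = w , 0<τ , on-geodesic
      where
      τ = d u w
      W = sum (map (d w) A)

      F-at-w : F G d σ w ≡ p * τ + q * W
      F-at-w = begin
        sum (map (d w) σ)                                                 ≡⟨ sum-map-++ (d w) (copies p [ u ]) (copies q A) ⟩
        sum (map (d w) (copies p [ u ])) + sum (map (d w) (copies q A))   ≡⟨ cong₂ _+_ (sum-map-copies (d w) p [ u ]) (sum-map-copies (d w) q A) ⟩
        p * (d w u + 0) + q * W                                           ≡⟨ cong (λ n → p * n + q * W) (trans (+-identityʳ (d w u)) (d-sym w u)) ⟩
        p * τ + q * W                                                     ∎
        where open ≡-Reasoning

      F<qT : p * τ + q * W < q * T
      F<qT = *-cancelˡ-< 2 _ _ (begin-strict
        2 * (p * τ + q * W)   ≡⟨ cong (2 *_) F-at-w ⟨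
        2 * F G d σ w         ≤⟨ 2F≤Σg ⟩
        sum (map g σ)         <⟨ n<1+n _ ⟩
        suc (sum (map g σ))   ≡⟨ total-weight ⟩
        2 * (q * T)           ∎)
        where open ≤-Reasoning

      T≤kτ+W : T ≤ length A * τ + W
      T≤kτ+W = ≤-trans (sum-map-mono-≤ A λ {x} _ → d-triangle u w x) (≤-reflexive (sum-map-+ τ (d w) A))

      copy-count : suc p ≡ length A * q
      copy-count = count (length as) T
        where
        count : ∀ l T → suc (l * suc T + T) ≡ suc l * suc T
        count = solve-∀

      0<τ : 0 < τ
      0<τ = proj₁ (descent-arithmetic {length A} copy-count F<qT T≤kτ+W)

      on-geodesic : ∀ {x} → x ∈ A → τ + d w x ≤ d u x
      on-geodesic = pointwise-≤∧sum-≥⇒pointwise-≥ A (λ {x} _ → d-triangle u w x)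
        (subst (_≤ T) (sym (sum-map-+ τ (d w) A)) (proj₂ (descent-arithmetic {length A} copy-count F<qT T≤kτ+W)))

  closer-neighbour : ∀ u {a} A → a ∈ A → (∀ {x y} → x ∈ A → y ∈ A → d x y + 2 ≤ d u x + d u y) →
                     ∃ λ u' → u ~ u' × (∀ {x} → x ∈ A → d u' x < d u x)
  closer-neighbour u (a ∷ as) _ spread =
    let w , 0<τ , on-geodesic = median-on-geodesics u a as spread
        u' , u~u' , d<τ = step-towards u w 0<τ
    in u' , u~u' , λ {x} x∈ → begin-strict
      d u' x          ≤⟨ d-triangle u' w x ⟩
      d u' w + d w x  <⟨ +-monoˡ-< (d w x) d<τ ⟩
      d u w + d w x   ≤⟨ on-geodesic x∈ ⟩
      d u x           ∎
    where open ≤-Reasoning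

  equidistant-neighbours-descend : ∀ {m y u v} → d y u ≡ 2 + m → d y v ≡ 2 + m → u ~ v →
                                   ∃ λ y' → d y' u ≡ suc m × d y' v ≡ suc m
  equidistant-neighbours-descend {m} {y} {u} {v} yu yv u~v =
    let y' , y~y' , closer = closer-neighbour y (u ∷ v ∷ []) (here refl) spread
    in y' , suc-injective (trans (~∧d<⇒suc-d≡d y~y' (closer (here refl))) yu)
          , suc-injective (trans (~∧d<⇒suc-d≡d y~y' (closer (there (here refl)))) yv)
    where
    spread : ∀ {a b} → a ∈ u ∷ v ∷ [] → b ∈ u ∷ v ∷ [] → d a b + 2 ≤ d y a + d y b
    spread {a} {b} a∈ b∈ = begin
      d a b + 2              ≤⟨ +-monoˡ-≤ 2 (clique⇒d≤1 (clique-∷ (u~v ∷ []) (clique-∷ [] λ ())) a∈ b∈) ⟩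
      3                      ≤⟨ s≤s (s≤s (m≤n+m 1 m)) ⟩
      2 + m + 1              ≤⟨ +-monoʳ-≤ (2 + m) (s≤s z≤n) ⟩
      2 + m + (2 + m)        ≡⟨ cong₂ _+_ (All.lookup at-2+m a∈) (All.lookup at-2+m b∈) ⟨
      d y a + d y b          ∎
      where
      open ≤-Reasoning
      at-2+m : All (λ x → d y x ≡ 2 + m) (u ∷ v ∷ [])
      at-2+m = yu ∷ yv ∷ []

  equidistant-non-adjacent : ∀ n {y u v} → d y u ≡ n → d y v ≡ n → ¬ (u ~ v)
  equidistant-non-adjacent zero {y} {u} {v} yu yv = subst (λ x → ¬ (x ~ v)) (trans (sym (d≡0⇒≡ yv)) (d≡0⇒≡ yu)) ~-irrefl
  equidistant-non-adjacent (suc zero) yu yv = triangle-free (d≡1⇒~ yu) (d≡1⇒~ yv)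
  equidistant-non-adjacent (suc (suc m)) yu yv u~v =
    let y' , y'u , y'v = equidistant-neighbours-descend yu yv u~v
    in equidistant-non-adjacent (suc m) y'u y'v u~v

  -- The median of the empty profile: the only way to obtain a vertex, as V may a priori be empty.
  root : V
  root = proj₁ (proj₂ (proj₂ (dpp [])))

  colour : V → Bool
  colour x = odd (d root x)

  colour-flips : ∀ {u v} → u ~ v → colour v ≡ not (colour u)
  colour-flips {u} {v} u~v with <-cmp (d root u) (d root v)
  ... | tri< u<v _ _ = cong odd (≤-antisym (~⇒d-≤-sucʳ u~v root) u<v)
  ... | tri≈ _ u≡v _ = ⊥-elim (equidistant-non-adjacent _ refl (sym u≡v) u~v)
  ... | tri> _ _ v<u = trans (sym (not-involutive (colour v))) (cong (not ∘ odd) (sym (≤-antisym (~⇒d-≤-sucʳ (~-sym u~v) root) v<u)))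

  colour-proper : ProperColouring G d colour
  colour-proper u~v cu≡cv = not-¬ refl (trans cu≡cv (colour-flips u~v))

  odd-distance : ∀ a b → odd (d a b) ≡ colour a xor colour b
  odd-distance a b = walk-parity G colour colour-flips (geodesic a b)

  module Descent (β : Bool) (ℱ : List (V × ℕ))
                 (compatible : ∀ {v s v' s'} → (v , s) ∈ ℱ → (v' , s') ∈ ℱ → d v v' ≤ s + s')
                 (aligned : ∀ {v s} → (v , s) ∈ ℱ → odd s ≡ colour v xor β)
                 (β-vertex : ∃ λ x → colour x ≡ β) where

    Near : ℕ → V → Set
    Near n x = ∀ {v s} → (v , s) ∈ ℱ → d v x ≤ n + s

    parity-match : ∀ {x v s} → colour x ≡ β → (v , s) ∈ ℱ → odd (d v x) ≡ odd s
    parity-match {x} {v} cx vs∈ = trans (odd-distance v x) (trans (cong (colour v xor_) cx) (sym (aligned vs∈)))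

    parity-mismatch : ∀ {x v s} → colour x ≢ β → (v , s) ∈ ℱ → odd (d v x) ≢ odd s
    parity-mismatch {x} {v} cx vs∈ odd≡ = cx (xor-injectiveʳ (colour v) (trans (sym (odd-distance v x)) (trans odd≡ (aligned vs∈))))

    settle : ∀ u → Near 0 u → ∃ λ x → colour x ≡ β × Near 0 x
    settle u near with colour u ≟ᴮ β
    ... | yes cu = u , cu , near
    ... | no cu =
      let x , cx = β-vertex
          y , u~y , _ = step-towards u x (n≢0⇒n>0 λ d≡0 → cu (trans (cong colour (d≡0⇒≡ d≡0)) cx))
      in y , trans (colour-flips u~y) (trans (cong not (¬-not cu)) (not-involutive β))
           , λ {v} vs∈ → ≤-trans (~⇒d-≤-sucʳ u~y v) (≤∧odd≢⇒< (near vs∈) (parity-mismatch cu vs∈))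

    Outside : V → V × ℕ → Set
    Outside u (v , s) = s < d v u

    outside? : ∀ u → Decidable (Outside u)
    outside? u (v , s) = s <? d v u

    outside : V → List V
    outside u = map proj₁ (filter (outside? u) ℱ)

    outside-spread : ∀ {u x y} → x ∈ outside u → y ∈ outside u → d x y + 2 ≤ d u x + d u y
    outside-spread {u} {x} {y} x∈ y∈ with ∈-map⁻ proj₁ x∈ | ∈-map⁻ proj₁ y∈
    ... | (x , s) , xs∈ , refl | (y , s') , ys'∈ , refl with ∈-filter⁻ (outside? u) xs∈ | ∈-filter⁻ (outside? u) ys'∈
    ... | xs∈ℱ , s<x | ys'∈ℱ , s'<y = begin
      d x y + 2        ≤⟨ +-monoˡ-≤ 2 (compatible xs∈ℱ ys'∈ℱ) ⟩
      s + s' + 2       ≡⟨ identity s s' ⟩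
      suc s + suc s'   ≤⟨ +-mono-≤ s<x s'<y ⟩
      d x u + d y u    ≡⟨ cong₂ _+_ (d-sym x u) (d-sym y u) ⟩
      d u x + d u y    ∎
      where
      open ≤-Reasoning
      identity : ∀ a b → a + b + 2 ≡ suc a + suc b
      identity = solve-∀

    ∈-outside⁺ : ∀ {u v s} → (v , s) ∈ ℱ → s < d v u → v ∈ outside u
    ∈-outside⁺ {u} vs∈ s<d = ∈-map⁺ proj₁ (∈-filter⁺ (outside? u) vs∈ s<d)

    -- Centres that u is inside of get at most one step farther. When u has colour β this costs a
    -- unit of slack, which exists: by parity the outside centre a is at distance ≥ sa + 2 from u.
    step-near : ∀ {n u u' a sa} → Near (suc n) u → (a , sa) ∈ ℱ → sa < d a u → u ~ u' →
                (∀ {x} → x ∈ outside u → d u' x < d u x) → Near n u'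
    step-near {n} {u} {u'} near _ _ u~u' closer {v} {s} vs∈ with s <? d v u
    ... | yes s<v = ≤-pred (begin-strict
      d v u'     ≡⟨ d-sym v u' ⟩
      d u' v     <⟨ closer (∈-outside⁺ vs∈ s<v) ⟩
      d u v      ≡⟨ d-sym u v ⟩
      d v u      ≤⟨ near vs∈ ⟩
      suc n + s  ∎)
      where open ≤-Reasoning
    step-near {n} {u} {u'} near as∈ sa<a u~u' closer {v} {s} vs∈ | no s≮v =
      ≤-trans (~⇒d-≤-sucʳ u~u' v) (one-more (≮⇒≥ s≮v))
      where
      one-more : d v u ≤ s → suc (d v u) ≤ n + s
      one-more v≤s with colour u ≟ᴮ β
      ... | no cu = ≤-trans (≤∧odd≢⇒< v≤s (parity-mismatch cu vs∈)) (m≤n+m s n)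
      ... | yes cu = ≤-trans (s≤s v≤s) (+-monoˡ-≤ s (≤-pred (+-cancelʳ-≤ _ 2 (suc n)
                       (≤-trans (<∧odd≡⇒2+≤ sa<a (sym (parity-match cu as∈))) (near as∈)))))

    descend : ∀ n u → Near n u → ∃ λ x → colour x ≡ β × Near 0 x
    descend zero u near = settle u near
    descend (suc n) u near with any? (outside? u) ℱ
    ... | no none-outside = settle u λ vs∈ → ≮⇒≥ λ s<d → none-outside (lose vs∈ s<d)
    ... | yes some-outside =
      let (a , sa) , as∈ , sa<a = find some-outside
          u' , u~u' , closer = closer-neighbour u (outside u) (∈-outside⁺ as∈ sa<a) outside-spread
      in descend n u' (step-near near as∈ sa<a u~u' closer)

  half-ball-helly : HalfBallHelly G d colour
  half-ball-helly [] _ = root , λ ()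
  half-ball-helly ℱ@((v₀ , r₀ , β) ∷ _) meet =
    let x , cx , covers = Descent.descend β (map tighten ℱ) compatible aligned β-vertex _ v₀ start
    in x , λ {(v , r , b)} H∈ → ≤-trans (covers (∈-map⁺ tighten H∈)) (align-≤ _ r) , trans cx (sym (uniform H∈))
    where
    tighten : HalfBall G d → V × ℕ
    tighten (v , r , _) = v , align (colour v xor β) r

    uniform : ∀ {v r b} → (v , r , b) ∈ ℱ → b ≡ β
    uniform H∈ = let _ , (_ , cz≡β) , (_ , cz≡b) = meet (here refl) H∈ in trans (sym cz≡b) cz≡β

    tighten-keeps : ∀ {v r b z} → (v , r , b) ∈ ℱ → _∈HB_ G d colour z (v , r , b) →
                    d v z ≤ align (colour v xor β) r × odd (align (colour v xor β) r) ≡ colour v xor β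
    tighten-keeps {v} {z = z} H∈ (vz≤r , cz≡b) =
      align-maximal (trans (odd-distance v z) (cong (colour v xor_) (trans cz≡b (uniform H∈)))) vz≤r

    compatible : ∀ {v s v' s'} → (v , s) ∈ map tighten ℱ → (v' , s') ∈ map tighten ℱ → d v v' ≤ s + s'
    compatible vs∈ vs'∈ with ∈-map⁻ tighten vs∈ | ∈-map⁻ tighten vs'∈
    ... | (v , r , b) , H∈ , refl | (v' , r' , b') , H'∈ , refl =
      let z , z∈H , z∈H' = meet H∈ H'∈
      in ≤-trans (d-triangle v z v')
           (+-mono-≤ (proj₁ (tighten-keeps H∈ z∈H)) (subst (_≤ align (colour v' xor β) r') (d-sym v' z) (proj₁ (tighten-keeps H'∈ z∈H'))))

    aligned : ∀ {v s} → (v , s) ∈ map tighten ℱ → odd s ≡ colour v xor β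
    aligned vs∈ with ∈-map⁻ tighten vs∈
    ... | (v , r , b) , H∈ , refl = let z , z∈H , _ = meet H∈ H∈ in proj₂ (tighten-keeps H∈ z∈H)

    β-vertex : ∃ λ x → colour x ≡ β
    β-vertex = let z , (_ , cz≡β) , _ = meet (here refl) (here refl) in z , cz≡β

    start : ∀ {v s} → (v , s) ∈ map tighten ℱ → d v v₀ ≤ align (colour v₀ xor β) r₀ + s
    start {v} {s} vs∈ = subst (d v v₀ ≤_) (+-comm s _) (compatible vs∈ (here refl))

proposition27 : (G : Graph) (d : Graph.V G → Graph.V G → ℕ) →
    IsDistance G d → DoublePairingProperty G d → BipartiteHelly G d
proposition27 G d isD dpp = colour , colour-proper , half-ball-helly
  where open DoublePairing G d isD dpp
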